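{- Let $\{G_k^*(x)\}$ be a generalized Fibonacci polynomial sequence of Lucas type, and let $n=mq+r$ where $m,q,r$ are positive integers with $r<m$. Let $m_1=m-r$ if $q$ is odd and $m_1=r$ if $q$ is even. Then $\gcd(G_n^*(x),G_m^*(x))=\gcd(G_{m_1}^*(x),G_m^*(x))$.
   Context: All polynomials lie in $\mathbb{Z}[x]$ and $\gcd$ denotes the greatest common divisor in $\mathbb{Z}[x]$ (determined up to sign). A generalized Fibonacci polynomial (GFP) sequence $\{G_n(x)\}_{n\ge0}$ is given by $G_0(x)=p_0(x)$, $G_1(x)=p_1(x)$ and $G_n(x)=d(x)G_{n-1}(x)+g(x)G_{n-2}(x)$ for $n\ge 2$, where $p_0(x)$ is a constant and $p_1(x),d(x),g(x)$ are nonzero polynomials in $\mathbb{Z}[x]$ with $\gcd(d(x),g(x))=1$; as in the paper it is assumed that $d(x)^2+4g(x)>0$. Let $a,b$ be the roots of $z^2-d(x)z-g(x)=0$. The sequence is of Lucas type if $p_0\ne 0$, $2p_1(x)=p_0\,d(x)$, $|p_0|\in\{1,2\}$, and $\gcd(p_0,p_1(x))=\gcd(p_0,d(x))=\gcd(p_0,g(x))=1$; then, with $\alpha=2/p_0$, $G_n=(a^n+b^n)/\alpha$ (denoted $G_n^*$). -}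

module Defs where

open import Data.Nat as ℕ using (ℕ; zero; suc; _%_; _∸_)
open import Data.Integer as ℤ using (ℤ; 0ℤ; 1ℤ; +_)
open import Data.Rational as ℚ using (ℚ)
open import Data.List using (List; []; _∷_)
open import Data.Product using (Σ; _×_)
import Data.Sum
open import Relation.Binary.PropositionalEquality using (_≡_)
open import Relation.Nullary using (¬_)

-- Polynomials in ℤ[x] as coefficient lists (constant term first).
Poly : Set
Poly = List ℤ

coeff : Poly → ℕ → ℤ
coeff []       _       = 0ℤ
coeff (a ∷ p)  zero    = a
coeff (a ∷ p)  (suc i) = coeff p i

-- Equality of polynomials: all coefficients agree (trailing zeros irrelevant).
infix 4 _≈ₚ_
_≈ₚ_ : Poly → Poly → Set
p ≈ₚ q = ∀ i → coeff p i ≡ coeff q i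

const : ℤ → Poly
const c = c ∷ []

infixl 6 _+ₚ_
_+ₚ_ : Poly → Poly → Poly
[]      +ₚ q       = q
(a ∷ p) +ₚ []      = a ∷ p
(a ∷ p) +ₚ (b ∷ q) = (a ℤ.+ b) ∷ (p +ₚ q)

scale : ℤ → Poly → Poly
scale c []      = []
scale c (a ∷ p) = (c ℤ.* a) ∷ scale c p

infixl 7 _*ₚ_
_*ₚ_ : Poly → Poly → Poly
[]      *ₚ q = []
(a ∷ p) *ₚ q = scale a q +ₚ (0ℤ ∷ (p *ₚ q))

evalℚ : Poly → ℚ → ℚ
evalℚ []      x = ℚ.0ℚ
evalℚ (a ∷ p) x = (a ℚ./ 1) ℚ.+ x ℚ.* evalℚ p x

infix 4 _∣ₚ_
_∣ₚ_ : Poly → Poly → Set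
a ∣ₚ b = Σ Poly (λ c → a *ₚ c ≈ₚ b)

-- h is a gcd of a and b in ℤ[x] (gcd is determined up to sign / units).
IsGCD : Poly → Poly → Poly → Set
IsGCD h a b = (h ∣ₚ a) × (h ∣ₚ b) × (∀ c → c ∣ₚ a → c ∣ₚ b → c ∣ₚ h)

NonZeroPoly : Poly → Set
NonZeroPoly p = ¬ (p ≈ₚ [])

G : ℤ → Poly → Poly → Poly → ℕ → Poly
G p₀ p₁ d g zero          = const p₀
G p₀ p₁ d g (suc zero)    = p₁
G p₀ p₁ d g (suc (suc n)) = d *ₚ G p₀ p₁ d g (suc n) +ₚ g *ₚ G p₀ p₁ d g n

record IsGFP (p₀ : ℤ) (p₁ d g : Poly) : Set where
  field
    p₁≢0   : NonZeroPoly p₁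
    d≢0    : NonZeroPoly d
    g≢0    : NonZeroPoly g
    gcd-dg : IsGCD (const 1ℤ) d g
    disc>0 : ∀ (x : ℚ) → ℚ.0ℚ ℚ.< evalℚ (d *ₚ d +ₚ scale (+ 4) g) x

record IsLucasType (p₀ : ℤ) (p₁ d g : Poly) : Set where
  field
    p₀≢0    : ¬ (p₀ ≡ 0ℤ)
    2p₁≈p₀d : const (+ 2) *ₚ p₁ ≈ₚ const p₀ *ₚ d
    |p₀|    : (ℤ.∣ p₀ ∣ ≡ 1) Data.Sum.⊎ (ℤ.∣ p₀ ∣ ≡ 2)
    gcd-p₀p₁ : IsGCD (const 1ℤ) (const p₀) p₁
    gcd-p₀d  : IsGCD (const 1ℤ) (const p₀) d
    gcd-p₀g  : IsGCD (const 1ℤ) (const p₀) g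

m₁ : ℕ → ℕ → ℕ → ℕ
m₁ m q r with q % 2
... | zero  = r
... | suc _ = m ∸ r

{-# OPTIONS --safe #-}
-- Let W be the Lucas sequence (W₀ = 2, W₁ = d) of the recurrence. Every solution G of the recurrence
-- satisfies G(v+2k) + (−g)ᵏ G(v) = G(v+k) Wₖ, and for a sequence of Lucas type p₀ W = 2 G, so
-- G(v+k) Wₖ = G(k) W(v+k). A common divisor of G(m) is coprime to g, hence to (−g)ᵏ, so it divides
-- G(n + 2m) iff it divides G(n) (k = m, v = n), and it divides G(m + r) iff it divides G(m − r)
-- (k = r, v = m − r). Stepping q down by two reduces G(mq + r) to G(r) or to G(m − r) = G(m₁).
-- Cancelling (−g)ᵏ is Euclid's lemma in ℤ[x], proved by splitting off contents, Gauss's lemma,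
-- and a descent on the degrees of primitive polynomials along pseudo-remainders.
module Submission where

open import Defs
open import Level using (0ℓ; _⊔_)
open import Algebra.Bundles using (CommutativeRing)
open import Data.Nat as ℕ using (ℕ; zero; suc; _∸_)
import Data.Nat.Properties as ℕ
import Data.Nat.Divisibility as ℕ
import Data.Nat.Tactic.RingSolver as ℕ-Solver
open import Data.Nat.GCD using (gcd; gcd[m,n]∣m; gcd[m,n]∣n; gcd-greatest)
open import Data.Nat.ListAction using (product)
open import Data.Nat.Primality using (Prime; euclidsLemma; prime⇒nonZero; prime⇒nonTrivial)
open import Data.Nat.Primality.Factorisation using (factorise; PrimeFactorisation)
open import Data.Integer using (ℤ; +_; -[1+_]; 0ℤ; 1ℤ; -1ℤ)
import Data.Integer as ℤ
import Data.Integer.Properties as ℤ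
import Data.Integer.Divisibility.Signed as ℤ
open import Data.Integer.Tactic.RingSolver using (solve-∀)
open import Data.List using ([]; _∷_; length)
open import Data.List.Relation.Unary.All using (All; []; _∷_)
open import Data.Product using (∃; _×_; _,_; proj₁; proj₂)
open import Data.Sum using (_⊎_; inj₁; inj₂)
open import Function.Bundles using (_⇔_; mk⇔; Equivalence)
open import Function.Construct.Composition using (_⇔-∘_)
open import Function.Construct.Symmetry using (⇔-sym)
open import Relation.Binary.Bundles using (Setoid)
import Relation.Binary.Reasoning.Setoid
open import Relation.Binary.PropositionalEquality
  using (_≡_; _≢_; refl; sym; trans; cong; cong₂; subst; module ≡-Reasoning)
open import Relation.Nullary using (¬_; yes; no; contradiction)

module CommutativeRingProperties {c ℓ} (R : CommutativeRing c ℓ) where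

  open CommutativeRing R renaming (Carrier to A; refl to ≈-refl; sym to ≈-sym; trans to ≈-trans)
  open import Algebra.Properties.Ring ring using (-‿distribˡ-*; -‿distribʳ-*; -‿involutive; xyx⁻¹≈y)
  open import Algebra.Properties.CommutativeSemigroup *-commutativeSemigroup using (x∙yz≈y∙xz)
  open import Algebra.Properties.CommutativeSemigroup +-commutativeSemigroup
    using () renaming (interchange to +-interchange)
  open import Algebra.Properties.Semiring.Divisibility semiring public
  open import Algebra.Properties.CommutativeSemigroup.Divisibility *-commutativeSemigroup public
    using (x∣xy)
  open import Algebra.Properties.Semiring.Primality semiring public using (Coprime; Coprime-sym)
  open import Algebra.Properties.Semiring.Exp semiring public using (_^_)
  open import Relation.Binary.Reasoning.Setoid setoid

  ∣x∣y⇒∣x+y : ∀ {z x y} → z ∣ x → z ∣ y → z ∣ x + y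
  ∣x∣y⇒∣x+y {z} (p , pz≈x) (q , qz≈y) = p + q , ≈-trans (distribʳ z p q) (+-cong pz≈x qz≈y)

  ∣x⇒∣-x : ∀ {z x} → z ∣ x → z ∣ - x
  ∣x⇒∣-x {z} (p , pz≈x) = - p , ≈-trans (≈-sym (-‿distribˡ-* p z)) (-‿cong pz≈x)

  ∣x+y∣x⇒∣y : ∀ {z x y} → z ∣ x + y → z ∣ x → z ∣ y
  ∣x+y∣x⇒∣y {x = x} {y} z∣x+y z∣x =
    ∣ʳ-respʳ-≈ (xyx⁻¹≈y x y) (∣x∣y⇒∣x+y z∣x+y (∣x⇒∣-x z∣x))

  ∣x+y∣y⇒∣x : ∀ {z x y} → z ∣ x + y → z ∣ y → z ∣ x
  ∣x+y∣y⇒∣x {x = x} {y} z∣x+y = ∣x+y∣x⇒∣y (∣ʳ-respʳ-≈ (+-comm x y) z∣x+y)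

  ∣-unit-cancel : ∀ {u z x} → u ∣ 1# → z ∣ u * x → z ∣ x
  ∣-unit-cancel {u} {x = x} (v , vu≈1) z∣ux = ∣ʳ-respʳ-≈ vux≈x (x∣ʳy⇒x∣ʳzy v z∣ux)
    where
    vux≈x : v * (u * x) ≈ x
    vux≈x = ≈-trans (≈-sym (*-assoc v u x)) (≈-trans (*-congʳ vu≈1) (*-identityˡ x))

  Coprime-∣ˡ : ∀ {x y z} → Coprime x y → z ∣ x → Coprime z y
  Coprime-∣ˡ coprime z∣x w∣z = coprime (∣ʳ-trans w∣z z∣x)

  Coprime-neg : ∀ {x y} → Coprime x y → Coprime x (- y)
  Coprime-neg coprime w∣x w∣-y = coprime w∣x (∣ʳ-respʳ-≈ (-‿involutive _) (∣x⇒∣-x w∣-y))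

  HasEuclidsLemma : Set (c ⊔ ℓ)
  HasEuclidsLemma = ∀ {z x y} → Coprime z x → z ∣ x * y → z ∣ y

  module _ (euclid : HasEuclidsLemma) where

    ∣-^-cancel : ∀ {z x y} → Coprime z x → ∀ j → z ∣ x ^ j * y → z ∣ y
    ∣-^-cancel {y = y} z⊥x zero    z∣1y       = ∣ʳ-respʳ-≈ (*-identityˡ y) z∣1y
    ∣-^-cancel {x = x} {y} z⊥x (suc j) z∣xxʲy =
      ∣-^-cancel z⊥x j (euclid z⊥x (∣ʳ-respʳ-≈ (*-assoc x (x ^ j) y) z∣xxʲy))

    Coprime-∣-* : ∀ {x y z w} → Coprime x w → Coprime y w → z ∣ x * y → Coprime z w
    Coprime-∣-* x⊥w y⊥w z∣xy v∣z v∣w =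
      y⊥w (euclid (λ u∣v u∣x → x⊥w u∣x (∣ʳ-trans u∣v v∣w)) (∣ʳ-trans v∣z z∣xy)) v∣w

    ∣-reduce : ∀ {z h x x′ y w} j → Coprime z h → z ∣ y → x + h ^ j * x′ ≈ y * w →
               z ∣ x ⇔ z ∣ x′
    ∣-reduce {z} {h} {x} {x′} {y} {w} j z⊥h z∣y e = mk⇔
      (λ z∣x → ∣-^-cancel z⊥h j (∣x+y∣x⇒∣y z∣x+hʲx′ z∣x))
      (λ z∣x′ → ∣x+y∣y⇒∣x z∣x+hʲx′ (x∣ʳy⇒x∣ʳzy (h ^ j) z∣x′))
      where
      z∣x+hʲx′ : z ∣ x + h ^ j * x′
      z∣x+hʲx′ = ∣ʳ-respʳ-≈ (≈-sym e) (∣ʳ-respʳ-≈ (*-comm w y) (x∣ʳy⇒x∣ʳzy w z∣y))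

  module Recurrence (d g : A) (G : ℕ → A)
                    (G-rec : ∀ n → G (suc (suc n)) ≈ d * G (suc n) + g * G n) where

    -- Wₖ = aᵏ + bᵏ for the roots a, b of z² − d·z − g.
    W : ℕ → A
    W zero          = 1# + 1#
    W (suc zero)    = d
    W (suc (suc n)) = d * W (suc n) + g * W n

    reindex : ∀ k v {n m} → k ℕ.+ (k ℕ.+ v) ≡ n → k ℕ.+ v ≡ m →
           G (k ℕ.+ (k ℕ.+ v)) + (- g) ^ k * G v ≈ G (k ℕ.+ v) * W k →
           G n + (- g) ^ k * G v ≈ G m * W k
    reindex k v refl refl e = e

    private
      -x*-y≈x*y : ∀ x y → - x * - y ≈ x * y
      -x*-y≈x*y x y = begin
        - x * - y     ≈⟨ -‿distribˡ-* x (- y) ⟨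
        - (x * - y)   ≈⟨ -‿cong (-‿distribʳ-* x y) ⟨
        - - (x * y)   ≈⟨ -‿involutive (x * y) ⟩
        x * y         ∎

      step-identity : ∀ p a b →
        d * ((- g * p) * a) + g * (p * (d * a + g * b)) ≈ (- g * (- g * p)) * b
      step-identity p a b = begin
        d * ((- g * p) * a) + g * (p * (d * a + g * b))
          ≈⟨ +-congˡ (*-congˡ (distribˡ p (d * a) (g * b))) ⟩
        d * ((- g * p) * a) + g * (p * (d * a) + p * (g * b))
          ≈⟨ +-congˡ (distribˡ g (p * (d * a)) (p * (g * b))) ⟩
        d * ((- g * p) * a) + (g * (p * (d * a)) + g * (p * (g * b)))
          ≈⟨ +-assoc _ _ _ ⟨
        (d * ((- g * p) * a) + g * (p * (d * a))) + g * (p * (g * b))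
          ≈⟨ +-congʳ (+-congʳ d[-gp]a≈-[gpda]) ⟩
        (- (g * (p * (d * a))) + g * (p * (d * a))) + g * (p * (g * b))
          ≈⟨ +-congʳ (-‿inverseˡ _) ⟩
        0# + g * (p * (g * b))
          ≈⟨ +-identityˡ _ ⟩
        g * (p * (g * b))
          ≈⟨ *-congˡ (x∙yz≈y∙xz p g b) ⟩
        g * (g * (p * b))
          ≈⟨ *-congˡ (*-assoc g p b) ⟨
        g * ((g * p) * b)
          ≈⟨ *-assoc g (g * p) b ⟨
        (g * (g * p)) * b
          ≈⟨ *-congʳ (≈-trans (*-congˡ (≈-sym (-‿distribˡ-* g p))) (-x*-y≈x*y g (g * p))) ⟨
        (- g * (- g * p)) * b
          ∎
        where
        d[-gp]a≈-[gpda] : d * ((- g * p) * a) ≈ - (g * (p * (d * a)))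
        d[-gp]a≈-[gpda] = begin
          d * ((- g * p) * a)   ≈⟨ *-congˡ (*-assoc (- g) p a) ⟩
          d * (- g * (p * a))   ≈⟨ x∙yz≈y∙xz d (- g) (p * a) ⟩
          - g * (d * (p * a))   ≈⟨ -‿distribˡ-* g (d * (p * a)) ⟨
          - (g * (d * (p * a))) ≈⟨ -‿cong (*-congˡ (x∙yz≈y∙xz d p a)) ⟩
          - (g * (p * (d * a))) ∎

    companion-step : ∀ k v →
      G (suc k ℕ.+ (suc k ℕ.+ suc v)) + (- g) ^ suc k * G (suc v) ≈ G (suc k ℕ.+ suc v) * W (suc k) →
      G (k ℕ.+ (k ℕ.+ (2 ℕ.+ v))) + (- g) ^ k * G (2 ℕ.+ v) ≈ G (k ℕ.+ (2 ℕ.+ v)) * W k →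
      G (2 ℕ.+ k ℕ.+ (2 ℕ.+ k ℕ.+ v)) + (- g) ^ (2 ℕ.+ k) * G v ≈ G (2 ℕ.+ k ℕ.+ v) * W (2 ℕ.+ k)
    companion-step k v IH₁ IH₂ = begin
      G (2 ℕ.+ k ℕ.+ m) + (- g * (- g * P)) * G v
        ≈⟨ +-cong (G-rec (k ℕ.+ m)) (≈-sym (step-identity P (G (suc v)) (G v))) ⟩
      (d * A₁ + g * A₂) + (d * B₁ + g * B₂)  ≈⟨ +-interchange _ _ _ _ ⟩
      (d * A₁ + d * B₁) + (g * A₂ + g * B₂)  ≈⟨ +-cong (distribˡ d A₁ B₁) (distribˡ g A₂ B₂) ⟨
      d * (A₁ + B₁) + g * (A₂ + B₂)          ≈⟨ +-cong (*-congˡ shifted-by-one) (*-congˡ shifted-by-two) ⟩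
      d * (G m * W (1 ℕ.+ k)) + g * (G m * W k)
        ≈⟨ +-cong (x∙yz≈y∙xz d (G m) _) (x∙yz≈y∙xz g (G m) _) ⟩
      G m * (d * W (1 ℕ.+ k)) + G m * (g * W k)
        ≈⟨ distribˡ (G m) _ _ ⟨
      G m * W (2 ℕ.+ k)
        ∎
      where
      P  = (- g) ^ k
      m  = 2 ℕ.+ k ℕ.+ v
      A₁ = G (1 ℕ.+ k ℕ.+ m)
      A₂ = G (k ℕ.+ m)
      B₁ = (- g * P) * G (suc v)
      B₂ = P * (d * G (suc v) + g * G v)
      shifted-by-one : A₁ + B₁ ≈ G m * W (1 ℕ.+ k)
      shifted-by-one =
        reindex (suc k) (suc v) (cong (λ n → suc (k ℕ.+ suc n)) (ℕ.+-suc k v)) (cong suc (ℕ.+-suc k v)) IH₁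
      shifted-by-two : A₂ + B₂ ≈ G m * W k
      shifted-by-two = ≈-trans (+-congˡ (*-congˡ (≈-sym (G-rec v))))
                               (reindex k (2 ℕ.+ v) (cong (k ℕ.+_) k+[2+v]≡m) k+[2+v]≡m IH₂)
        where
        k+[2+v]≡m : k ℕ.+ (2 ℕ.+ v) ≡ m
        k+[2+v]≡m = trans (ℕ.+-suc k (suc v)) (cong suc (ℕ.+-suc k v))

    companion-identity : ∀ k v → G (k ℕ.+ (k ℕ.+ v)) + (- g) ^ k * G v ≈ G (k ℕ.+ v) * W k
    companion-identity zero v = begin
      G v + 1# * G v        ≈⟨ +-congˡ (*-identityˡ (G v)) ⟩
      G v + G v             ≈⟨ +-cong (*-identityʳ (G v)) (*-identityʳ (G v)) ⟨
      G v * 1# + G v * 1#   ≈⟨ distribˡ (G v) 1# 1# ⟨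
      G v * (1# + 1#)       ∎
    companion-identity (suc zero) v = begin
      G (2 ℕ.+ v) + (- g * 1#) * G v                ≈⟨ +-cong (G-rec v) (*-congʳ (*-identityʳ (- g))) ⟩
      (d * G (1 ℕ.+ v) + g * G v) + - g * G v       ≈⟨ +-congˡ (-‿distribˡ-* g (G v)) ⟨
      (d * G (1 ℕ.+ v) + g * G v) + - (g * G v)     ≈⟨ +-assoc _ _ _ ⟩
      d * G (1 ℕ.+ v) + (g * G v + - (g * G v))     ≈⟨ +-congˡ (-‿inverseʳ _) ⟩
      d * G (1 ℕ.+ v) + 0#                          ≈⟨ +-identityʳ _ ⟩
      d * G (1 ℕ.+ v)                               ≈⟨ *-comm d (G (1 ℕ.+ v)) ⟩
      G (1 ℕ.+ v) * d                               ∎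
    companion-identity (suc (suc k)) v =
      companion-step k v (companion-identity (suc k) (suc v)) (companion-identity k (2 ℕ.+ v))

    companion-identity′ : ∀ k v {n m} → k ℕ.+ (k ℕ.+ v) ≡ n → k ℕ.+ v ≡ m →
                          G n + (- g) ^ k * G v ≈ G m * W k
    companion-identity′ k v p q = reindex k v p q (companion-identity k v)

    W-proportional : ∀ {a b} → a * W 0 ≈ b * G 0 → a * W 1 ≈ b * G 1 → ∀ k → a * W k ≈ b * G k
    W-proportional aW₀≈bG₀ aW₁≈bG₁ zero       = aW₀≈bG₀
    W-proportional aW₀≈bG₀ aW₁≈bG₁ (suc zero) = aW₁≈bG₁
    W-proportional {a} {b} aW₀≈bG₀ aW₁≈bG₁ (suc (suc k)) = begin
      a * (d * W (suc k) + g * W k)        ≈⟨ distribˡ a _ _ ⟩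
      a * (d * W (suc k)) + a * (g * W k)  ≈⟨ +-cong (x∙yz≈y∙xz a d _) (x∙yz≈y∙xz a g _) ⟩
      d * (a * W (suc k)) + g * (a * W k)  ≈⟨ +-cong (*-congˡ (W-proportional aW₀≈bG₀ aW₁≈bG₁ (suc k)))
                                                     (*-congˡ (W-proportional aW₀≈bG₀ aW₁≈bG₁ k)) ⟩
      d * (b * G (suc k)) + g * (b * G k)  ≈⟨ +-cong (x∙yz≈y∙xz d b _) (x∙yz≈y∙xz g b _) ⟩
      b * (d * G (suc k)) + b * (g * G k)  ≈⟨ distribˡ b _ _ ⟨
      b * (d * G (suc k) + g * G k)        ≈⟨ *-congˡ (G-rec k) ⟨
      b * G (2 ℕ.+ k)                      ∎

    G*W-symmetric : ∀ {a b} → (∀ {x y} → a * x ≈ a * y → x ≈ y) → (∀ k → a * W k ≈ b * G k) →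
                    ∀ s t → G s * W t ≈ G t * W s
    G*W-symmetric {a} {b} a-cancel W∝G s t = a-cancel (begin
      a * (G s * W t)   ≈⟨ x∙yz≈y∙xz a (G s) (W t) ⟩
      G s * (a * W t)   ≈⟨ *-congˡ (W∝G t) ⟩
      G s * (b * G t)   ≈⟨ x∙yz≈y∙xz (G s) b (G t) ⟩
      b * (G s * G t)   ≈⟨ *-congˡ (*-comm (G s) (G t)) ⟩
      b * (G t * G s)   ≈⟨ x∙yz≈y∙xz b (G t) (G s) ⟩
      G t * (b * G s)   ≈⟨ *-congˡ (W∝G s) ⟨
      G t * (a * W s)   ≈⟨ x∙yz≈y∙xz a (G t) (W s) ⟨
      a * (G t * W s)   ∎)

    G≡d^i*G₁-mod-g : ∀ i → ∃ λ y → G (suc i) ≈ d ^ i * G 1 + g * y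
    G≡d^i*G₁-mod-g zero = 0# , (begin
      G 1               ≈⟨ *-identityˡ (G 1) ⟨
      1# * G 1          ≈⟨ +-identityʳ _ ⟨
      1# * G 1 + 0#     ≈⟨ +-congˡ (zeroʳ g) ⟨
      1# * G 1 + g * 0# ∎)
    G≡d^i*G₁-mod-g (suc i) with G≡d^i*G₁-mod-g i
    ... | y , G[1+i]≈ = d * y + G i , (begin
      G (2 ℕ.+ i)                                ≈⟨ G-rec i ⟩
      d * G (suc i) + g * G i                    ≈⟨ +-congʳ (*-congˡ G[1+i]≈) ⟩
      d * (d ^ i * G 1 + g * y) + g * G i        ≈⟨ +-congʳ (distribˡ d _ _) ⟩
      (d * (d ^ i * G 1) + d * (g * y)) + g * G i ≈⟨ +-assoc _ _ _ ⟩
      d * (d ^ i * G 1) + (d * (g * y) + g * G i)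
        ≈⟨ +-cong (*-assoc d (d ^ i) (G 1)) (+-congʳ (x∙yz≈y∙xz g d y)) ⟨
      (d * d ^ i) * G 1 + (g * (d * y) + g * G i) ≈⟨ +-congˡ (distribˡ g _ _) ⟨
      d ^ suc i * G 1 + g * (d * y + G i)        ∎)

    module _ (euclid : HasEuclidsLemma) (G₁⊥g : Coprime (G 1) g) (d⊥g : Coprime d g) where

      G⊥g : ∀ i → Coprime (G (suc i)) g
      G⊥g i {z} z∣G z∣g with G≡d^i*G₁-mod-g i
      ... | y , G[1+i]≈ = G₁⊥g (∣-^-cancel euclid z⊥d i z∣dⁱG₁) z∣g
        where
        z⊥d : Coprime z d
        z⊥d w∣z w∣d = d⊥g w∣d (∣ʳ-trans w∣z z∣g)
        z∣dⁱG₁ : z ∣ d ^ i * G 1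
        z∣dⁱG₁ = ∣x+y∣y⇒∣x (∣ʳ-respʳ-≈ G[1+i]≈ z∣G) (∣ʳ-respʳ-≈ (*-comm y g) (x∣ʳy⇒x∣ʳzy y z∣g))

      ∣G-reduce : ∀ {z m′ n v w} k → z ∣ G (suc m′) →
                  G n + (- g) ^ k * G v ≈ G (suc m′) * w → z ∣ G n ⇔ z ∣ G v
      ∣G-reduce {m′ = m′} k z∣Gm =
        ∣-reduce euclid k (Coprime-neg (Coprime-∣ˡ (G⊥g m′) z∣Gm)) z∣Gm

      module _ (G*W-sym : ∀ s t → G s * W t ≈ G t * W s) where

        ∣G[mq+r]⇔∣G[m₁] : ∀ {z} m′ q′ r → r ℕ.< suc m′ → z ∣ G (suc m′) →
                          z ∣ G (suc m′ ℕ.* suc q′ ℕ.+ r) ⇔ z ∣ G (m₁ (suc m′) (suc q′) r)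
        ∣G[mq+r]⇔∣G[m₁] m′ zero r r<m z∣Gm =
          ∣G-reduce r z∣Gm (companion-identity′ r (m ∸ r) r+[r+[m∸r]]≡m*1+r r+[m∸r]≡m)
          where
          m = suc m′
          r+[m∸r]≡m : r ℕ.+ (m ∸ r) ≡ m
          r+[m∸r]≡m = ℕ.m+[n∸m]≡n (ℕ.<⇒≤ r<m)
          r+[r+[m∸r]]≡m*1+r : r ℕ.+ (r ℕ.+ (m ∸ r)) ≡ m ℕ.* 1 ℕ.+ r
          r+[r+[m∸r]]≡m*1+r = trans (cong (r ℕ.+_) r+[m∸r]≡m)
                                (trans (ℕ.+-comm r m) (cong (ℕ._+ r) (sym (ℕ.*-identityʳ m))))
        ∣G[mq+r]⇔∣G[m₁] m′ (suc zero) r r<m z∣Gm =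
          ∣G-reduce m z∣Gm (≈-trans (companion-identity′ m r (index m′ r) refl) (G*W-sym (m ℕ.+ r) m))
          where
          m = suc m′
          index : ∀ m′ r → suc m′ ℕ.+ (suc m′ ℕ.+ r) ≡ suc m′ ℕ.* 2 ℕ.+ r
          index = ℕ-Solver.solve-∀
        ∣G[mq+r]⇔∣G[m₁] m′ (suc (suc q)) r r<m z∣Gm =
          ∣G[mq+r]⇔∣G[m₁] m′ q r r<m z∣Gm ⇔-∘
          ∣G-reduce m z∣Gm (≈-trans (companion-identity′ m n′ (index m′ q r) refl) (G*W-sym (m ℕ.+ n′) m))
          where
          m = suc m′
          n′ = m ℕ.* suc q ℕ.+ r
          index : ∀ m′ q r → suc m′ ℕ.+ (suc m′ ℕ.+ (suc m′ ℕ.* suc q ℕ.+ r)) ≡ suc m′ ℕ.* (3 ℕ.+ q) ℕ.+ r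
          index = ℕ-Solver.solve-∀

-- A record around _≈ₚ_, so that both polynomials can be inferred from a proof.
infix 4 _≋_
record _≋_ (p q : Poly) : Set where
  constructor coeffwise
  field coeff-≡ : ∀ i → coeff p i ≡ coeff q i
open _≋_ public

coeff-+ₚ : ∀ p q i → coeff (p +ₚ q) i ≡ coeff p i ℤ.+ coeff q i
coeff-+ₚ []      q       i       = sym (ℤ.+-identityˡ (coeff q i))
coeff-+ₚ (a ∷ p) []      i       = sym (ℤ.+-identityʳ (coeff (a ∷ p) i))
coeff-+ₚ (a ∷ p) (b ∷ q) zero    = refl
coeff-+ₚ (a ∷ p) (b ∷ q) (suc i) = coeff-+ₚ p q i

coeff-scale : ∀ c p i → coeff (scale c p) i ≡ c ℤ.* coeff p i
coeff-scale c []      i       = sym (ℤ.*-zeroʳ c)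
coeff-scale c (a ∷ p) zero    = refl
coeff-scale c (a ∷ p) (suc i) = coeff-scale c p i

≋-refl : ∀ {p} → p ≋ p
≋-refl = coeffwise λ _ → refl

≋-sym : ∀ {p q} → p ≋ q → q ≋ p
≋-sym e = coeffwise λ i → sym (coeff-≡ e i)

≋-trans : ∀ {p q r} → p ≋ q → q ≋ r → p ≋ r
≋-trans e f = coeffwise λ i → trans (coeff-≡ e i) (coeff-≡ f i)

≋-setoid : Setoid 0ℓ 0ℓ
≋-setoid = record
  { Carrier = Poly ; _≈_ = _≋_
  ; isEquivalence = record { refl = ≋-refl ; sym = ≋-sym ; trans = ≋-trans } }

module ≋-Reasoning = Relation.Binary.Reasoning.Setoid ≋-setoid

∷-cong : ∀ {a b p q} → a ≡ b → p ≋ q → a ∷ p ≋ b ∷ q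
∷-cong a≡b p≋q = coeffwise λ where
  zero    → a≡b
  (suc i) → coeff-≡ p≋q i

∷-congʳ : ∀ {a p q} → p ≋ q → a ∷ p ≋ a ∷ q
∷-congʳ = ∷-cong refl

0∷[]≋[] : 0ℤ ∷ [] ≋ []
0∷[]≋[] = coeffwise λ where
  zero    → refl
  (suc i) → refl

+ₚ-coeffwise : ∀ p q r s → (∀ i → coeff p i ℤ.+ coeff q i ≡ coeff r i ℤ.+ coeff s i) →
               p +ₚ q ≋ r +ₚ s
+ₚ-coeffwise p q r s e =
  coeffwise λ i → trans (coeff-+ₚ p q i) (trans (e i) (sym (coeff-+ₚ r s i)))

+ₚ-cong : ∀ {p p′ q q′} → p ≋ p′ → q ≋ q′ → p +ₚ q ≋ p′ +ₚ q′
+ₚ-cong {p} {p′} {q} {q′} e f = +ₚ-coeffwise p q p′ q′ λ i → cong₂ ℤ._+_ (coeff-≡ e i) (coeff-≡ f i)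

+ₚ-comm : ∀ p q → p +ₚ q ≋ q +ₚ p
+ₚ-comm p q = +ₚ-coeffwise p q q p λ i → ℤ.+-comm (coeff p i) (coeff q i)

+ₚ-identityʳ : ∀ p → p +ₚ [] ≋ p
+ₚ-identityʳ []      = ≋-refl
+ₚ-identityʳ (a ∷ p) = ≋-refl

+ₚ-assoc : ∀ p q r → (p +ₚ q) +ₚ r ≋ p +ₚ (q +ₚ r)
+ₚ-assoc p q r = coeffwise λ i → begin
  coeff ((p +ₚ q) +ₚ r) i               ≡⟨ coeff-+ₚ (p +ₚ q) r i ⟩
  coeff (p +ₚ q) i ℤ.+ coeff r i        ≡⟨ cong₂ ℤ._+_ (coeff-+ₚ p q i) refl ⟩
  (coeff p i ℤ.+ coeff q i) ℤ.+ coeff r i ≡⟨ ℤ.+-assoc (coeff p i) (coeff q i) (coeff r i) ⟩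
  coeff p i ℤ.+ (coeff q i ℤ.+ coeff r i) ≡⟨ cong (ℤ._+_ (coeff p i)) (coeff-+ₚ q r i) ⟨
  coeff p i ℤ.+ coeff (q +ₚ r) i        ≡⟨ coeff-+ₚ p (q +ₚ r) i ⟨
  coeff (p +ₚ (q +ₚ r)) i               ∎
  where open ≡-Reasoning

+ₚ-interchange : ∀ w x y z → (w +ₚ x) +ₚ (y +ₚ z) ≋ (w +ₚ y) +ₚ (x +ₚ z)
+ₚ-interchange w x y z = +ₚ-coeffwise (w +ₚ x) (y +ₚ z) (w +ₚ y) (x +ₚ z) λ i →
  trans (cong₂ ℤ._+_ (coeff-+ₚ w x i) (coeff-+ₚ y z i))
        (trans (interchange (coeff w i) (coeff x i) (coeff y i) (coeff z i))
               (sym (cong₂ ℤ._+_ (coeff-+ₚ w y i) (coeff-+ₚ x z i))))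
  where
  interchange : ∀ a b c d → (a ℤ.+ b) ℤ.+ (c ℤ.+ d) ≡ (a ℤ.+ c) ℤ.+ (b ℤ.+ d)
  interchange = solve-∀

scale-coeffwise : ∀ {c p q} → (∀ i → c ℤ.* coeff p i ≡ coeff q i) → scale c p ≋ q
scale-coeffwise {c} {p} e = coeffwise λ i → trans (coeff-scale c p i) (e i)

scale-cong : ∀ {c p q} → p ≋ q → scale c p ≋ scale c q
scale-cong {c} {q = q} e =
  scale-coeffwise λ i → trans (cong (c ℤ.*_) (coeff-≡ e i)) (sym (coeff-scale c q i))

scale-distribˡ-+ₚ : ∀ c p q → scale c (p +ₚ q) ≋ scale c p +ₚ scale c q
scale-distribˡ-+ₚ c p q = scale-coeffwise λ i → begin
  c ℤ.* coeff (p +ₚ q) i                       ≡⟨ cong (c ℤ.*_) (coeff-+ₚ p q i) ⟩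
  c ℤ.* (coeff p i ℤ.+ coeff q i)              ≡⟨ ℤ.*-distribˡ-+ c (coeff p i) (coeff q i) ⟩
  c ℤ.* coeff p i ℤ.+ c ℤ.* coeff q i          ≡⟨ cong₂ ℤ._+_ (coeff-scale c p i) (coeff-scale c q i) ⟨
  coeff (scale c p) i ℤ.+ coeff (scale c q) i  ≡⟨ coeff-+ₚ (scale c p) (scale c q) i ⟨
  coeff (scale c p +ₚ scale c q) i             ∎
  where open ≡-Reasoning

scale-distribʳ-+ : ∀ a b p → scale (a ℤ.+ b) p ≋ scale a p +ₚ scale b p
scale-distribʳ-+ a b p = scale-coeffwise λ i → begin
  (a ℤ.+ b) ℤ.* coeff p i                      ≡⟨ ℤ.*-distribʳ-+ (coeff p i) a b ⟩
  a ℤ.* coeff p i ℤ.+ b ℤ.* coeff p i          ≡⟨ cong₂ ℤ._+_ (coeff-scale a p i) (coeff-scale b p i) ⟨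
  coeff (scale a p) i ℤ.+ coeff (scale b p) i  ≡⟨ coeff-+ₚ (scale a p) (scale b p) i ⟨
  coeff (scale a p +ₚ scale b p) i             ∎
  where open ≡-Reasoning

scale-scale : ∀ a b p → scale a (scale b p) ≋ scale (a ℤ.* b) p
scale-scale a b p = scale-coeffwise λ i →
  trans (cong (a ℤ.*_) (coeff-scale b p i))
        (trans (sym (ℤ.*-assoc a b (coeff p i))) (sym (coeff-scale (a ℤ.* b) p i)))

scale-comm : ∀ a b p → scale a (scale b p) ≋ scale b (scale a p)
scale-comm a b p = ≋-trans (scale-scale a b p) (≋-trans
  (scale-coeffwise λ i → trans (cong (ℤ._* coeff p i) (ℤ.*-comm a b)) (sym (coeff-scale (b ℤ.* a) p i)))
  (≋-sym (scale-scale b a p)))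

scale-zero : ∀ p → scale 0ℤ p ≋ []
scale-zero p = scale-coeffwise λ i → ℤ.*-zeroˡ (coeff p i)

scale-identity : ∀ p → scale 1ℤ p ≋ p
scale-identity p = scale-coeffwise λ i → ℤ.*-identityˡ (coeff p i)

scale-cancel : ∀ {k p q} → k ≢ 0ℤ → scale k p ≋ scale k q → p ≋ q
scale-cancel {k} {p} {q} k≢0 e = coeffwise λ i →
  ℤ.*-cancelˡ-≡ k (coeff p i) (coeff q i) {{ℤ.≢-nonZero k≢0}}
    (trans (sym (coeff-scale k p i)) (trans (coeff-≡ e i) (coeff-scale k q i)))

*ₚ-congʳ : ∀ p {q q′} → q ≋ q′ → p *ₚ q ≋ p *ₚ q′
*ₚ-congʳ []      e = ≋-refl
*ₚ-congʳ (a ∷ p) e = +ₚ-cong (scale-cong e) (∷-congʳ (*ₚ-congʳ p e))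

*ₚ-zeroʳ : ∀ p → p *ₚ [] ≋ []
*ₚ-zeroʳ []      = ≋-refl
*ₚ-zeroʳ (a ∷ p) = ≋-trans (∷-congʳ (*ₚ-zeroʳ p)) 0∷[]≋[]

*ₚ-identityʳ : ∀ p → p *ₚ const 1ℤ ≋ p
*ₚ-identityʳ []      = ≋-refl
*ₚ-identityʳ (a ∷ p) =
  ∷-cong (trans (ℤ.+-identityʳ (a ℤ.* 1ℤ)) (ℤ.*-identityʳ a)) (*ₚ-identityʳ p)

*ₚ-identityˡ : ∀ p → const 1ℤ *ₚ p ≋ p
*ₚ-identityˡ p = ≋-trans (+ₚ-cong (scale-identity p) 0∷[]≋[]) (+ₚ-identityʳ p)

*ₚ-distribˡ-+ₚ : ∀ p q q′ → p *ₚ (q +ₚ q′) ≋ p *ₚ q +ₚ p *ₚ q′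
*ₚ-distribˡ-+ₚ []      q q′ = ≋-refl
*ₚ-distribˡ-+ₚ (a ∷ p) q q′ = ≋-trans
  (+ₚ-cong (scale-distribˡ-+ₚ a q q′) (∷-cong (sym (ℤ.+-identityʳ 0ℤ)) (*ₚ-distribˡ-+ₚ p q q′)))
  (+ₚ-interchange (scale a q) (scale a q′) (0ℤ ∷ p *ₚ q) (0ℤ ∷ p *ₚ q′))

*ₚ-distribʳ-+ₚ : ∀ q p p′ → (p +ₚ p′) *ₚ q ≋ p *ₚ q +ₚ p′ *ₚ q
*ₚ-distribʳ-+ₚ q []      p′       = ≋-refl
*ₚ-distribʳ-+ₚ q (a ∷ p) []       = ≋-sym (+ₚ-identityʳ _)
*ₚ-distribʳ-+ₚ q (a ∷ p) (b ∷ p′) = ≋-trans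
  (+ₚ-cong (scale-distribʳ-+ a b q) (∷-cong (sym (ℤ.+-identityʳ 0ℤ)) (*ₚ-distribʳ-+ₚ q p p′)))
  (+ₚ-interchange (scale a q) (scale b q) (0ℤ ∷ p *ₚ q) (0ℤ ∷ p′ *ₚ q))

scale-*ₚ : ∀ c p q → scale c p *ₚ q ≋ scale c (p *ₚ q)
scale-*ₚ c []      q = ≋-refl
scale-*ₚ c (a ∷ p) q = ≋-trans
  (+ₚ-cong (≋-sym (scale-scale c a q)) (∷-cong (sym (ℤ.*-zeroʳ c)) (scale-*ₚ c p q)))
  (≋-sym (scale-distribˡ-+ₚ c (scale a q) (0ℤ ∷ p *ₚ q)))

*ₚ-scale : ∀ c p q → p *ₚ scale c q ≋ scale c (p *ₚ q)
*ₚ-scale c []      q = ≋-refl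
*ₚ-scale c (a ∷ p) q = ≋-trans
  (+ₚ-cong (scale-comm a c q) (∷-cong (sym (ℤ.*-zeroʳ c)) (*ₚ-scale c p q)))
  (≋-sym (scale-distribˡ-+ₚ c (scale a q) (0ℤ ∷ p *ₚ q)))

*ₚ-shiftʳ : ∀ p q → p *ₚ (0ℤ ∷ q) ≋ 0ℤ ∷ p *ₚ q
*ₚ-shiftʳ []      q = ≋-sym 0∷[]≋[]
*ₚ-shiftʳ (a ∷ p) q =
  ∷-cong (trans (ℤ.+-identityʳ (a ℤ.* 0ℤ)) (ℤ.*-zeroʳ a))
         (+ₚ-cong ≋-refl (*ₚ-shiftʳ p q))

*ₚ-∷ʳ : ∀ p a q → p *ₚ (a ∷ q) ≋ scale a p +ₚ (0ℤ ∷ p *ₚ q)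
*ₚ-∷ʳ p a q = begin
  p *ₚ (a ∷ q)                       ≈⟨ *ₚ-congʳ p (∷-cong (sym (ℤ.+-identityʳ a)) ≋-refl) ⟩
  p *ₚ (const a +ₚ (0ℤ ∷ q))         ≈⟨ *ₚ-distribˡ-+ₚ p (const a) (0ℤ ∷ q) ⟩
  p *ₚ const a +ₚ p *ₚ (0ℤ ∷ q)      ≈⟨ +ₚ-cong p*a≋a·p (*ₚ-shiftʳ p q) ⟩
  scale a p +ₚ (0ℤ ∷ p *ₚ q)         ∎
  where
  open ≋-Reasoning
  p*a≋a·p : p *ₚ const a ≋ scale a p
  p*a≋a·p = ≋-trans (*ₚ-congʳ p (∷-cong (sym (ℤ.*-identityʳ a)) ≋-refl))
              (≋-trans (*ₚ-scale a p (const 1ℤ)) (scale-cong (*ₚ-identityʳ p)))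

*ₚ-comm : ∀ p q → p *ₚ q ≋ q *ₚ p
*ₚ-comm []      q = ≋-sym (*ₚ-zeroʳ q)
*ₚ-comm (a ∷ p) q = ≋-sym (≋-trans (*ₚ-∷ʳ q a p) (+ₚ-cong ≋-refl (∷-congʳ (≋-sym (*ₚ-comm p q)))))

*ₚ-congˡ : ∀ {p p′} q → p ≋ p′ → p *ₚ q ≋ p′ *ₚ q
*ₚ-congˡ {p} {p′} q e = ≋-trans (*ₚ-comm p q) (≋-trans (*ₚ-congʳ q e) (*ₚ-comm q p′))

*ₚ-shiftˡ : ∀ p q → (0ℤ ∷ p) *ₚ q ≋ 0ℤ ∷ p *ₚ q
*ₚ-shiftˡ p q = +ₚ-cong (scale-zero q) ≋-refl

*ₚ-assoc : ∀ p q r → (p *ₚ q) *ₚ r ≋ p *ₚ (q *ₚ r)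
*ₚ-assoc []      q r = ≋-refl
*ₚ-assoc (a ∷ p) q r = ≋-trans (*ₚ-distribʳ-+ₚ r (scale a q) (0ℤ ∷ p *ₚ q))
  (+ₚ-cong (scale-*ₚ a q r) (≋-trans (*ₚ-shiftˡ (p *ₚ q) r) (∷-congʳ (*ₚ-assoc p q r))))

-ₚ_ : Poly → Poly
-ₚ p = scale -1ℤ p

-ₚ‿inverseˡ : ∀ p → (-ₚ p) +ₚ p ≋ []
-ₚ‿inverseˡ p = coeffwise λ i → begin
  coeff ((-ₚ p) +ₚ p) i                        ≡⟨ coeff-+ₚ (-ₚ p) p i ⟩
  coeff (-ₚ p) i ℤ.+ coeff p i                 ≡⟨ cong (ℤ._+ coeff p i) (coeff-scale -1ℤ p i) ⟩
  -1ℤ ℤ.* coeff p i ℤ.+ coeff p i           ≡⟨ cong (ℤ._+ coeff p i) (ℤ.-1*i≡-i (coeff p i)) ⟩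
  ℤ.- coeff p i ℤ.+ coeff p i                    ≡⟨ ℤ.+-inverseˡ (coeff p i) ⟩
  0ℤ                                           ∎
  where open ≡-Reasoning

ℤ[x] : CommutativeRing 0ℓ 0ℓ
ℤ[x] = record
  { Carrier = Poly ; _≈_ = _≋_ ; _+_ = _+ₚ_ ; _*_ = _*ₚ_ ; -_ = -ₚ_ ; 0# = [] ; 1# = const 1ℤ
  ; isCommutativeRing = record
    { isRing = record
      { +-isAbelianGroup = record
        { isGroup = record
          { isMonoid = record
            { isSemigroup = record
              { isMagma = record { isEquivalence = Setoid.isEquivalence ≋-setoid ; ∙-cong = +ₚ-cong }
              ; assoc = +ₚ-assoc }
            ; identity = (λ _ → ≋-refl) , +ₚ-identityʳ }
          ; inverse = -ₚ‿inverseˡ , λ p → ≋-trans (+ₚ-comm p (-ₚ p)) (-ₚ‿inverseˡ p)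
          ; ⁻¹-cong = scale-cong }
        ; comm = +ₚ-comm }
      ; *-cong = λ {p} {p′} {q} e f → ≋-trans (*ₚ-congˡ q e) (*ₚ-congʳ p′ f)
      ; *-assoc = *ₚ-assoc
      ; *-identity = *ₚ-identityˡ , *ₚ-identityʳ
      ; distrib = *ₚ-distribˡ-+ₚ , *ₚ-distribʳ-+ₚ }
    ; *-comm = *ₚ-comm } }

const-*ₚ : ∀ k p → const k *ₚ p ≋ scale k p
const-*ₚ k p = ≋-trans (+ₚ-cong ≋-refl 0∷[]≋[]) (+ₚ-identityʳ (scale k p))

infix 4 _∣ᶜ_
record _∣ᶜ_ (k : ℤ) (p : Poly) : Set where
  constructor coeffwise-∣
  field ∣-coeff : ∀ i → k ℤ.∣ coeff p i
open _∣ᶜ_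

∣ᶜ-resp-≋ : ∀ {k p q} → p ≋ q → k ∣ᶜ p → k ∣ᶜ q
∣ᶜ-resp-≋ p≋q k∣p = coeffwise-∣ λ i → subst (_ ℤ.∣_) (coeff-≡ p≋q i) (∣-coeff k∣p i)

∣ᶜ-trans : ∀ {j k p} → j ℤ.∣ k → k ∣ᶜ p → j ∣ᶜ p
∣ᶜ-trans j∣k k∣p = coeffwise-∣ λ i → ℤ.∣-trans j∣k (∣-coeff k∣p i)

_∣ᶜ[] : ∀ k → k ∣ᶜ []
k ∣ᶜ[] = coeffwise-∣ λ _ → ℤ.divides 0ℤ (sym (ℤ.*-zeroˡ k))

∣ᶜ-∷ : ∀ {k a p} → k ℤ.∣ a → k ∣ᶜ p → k ∣ᶜ a ∷ p
∣ᶜ-∷ k∣a k∣p = coeffwise-∣ λ where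
  zero    → k∣a
  (suc i) → ∣-coeff k∣p i

∣ᶜ-head : ∀ {k a p} → k ∣ᶜ a ∷ p → k ℤ.∣ a
∣ᶜ-head k∣a∷p = ∣-coeff k∣a∷p zero

∣ᶜ-tail : ∀ {k a p} → k ∣ᶜ a ∷ p → k ∣ᶜ p
∣ᶜ-tail k∣a∷p = coeffwise-∣ λ i → ∣-coeff k∣a∷p (suc i)

∣ᶜ-+ₚ-cancelˡ : ∀ {k} p q → k ∣ᶜ p +ₚ q → k ∣ᶜ p → k ∣ᶜ q
∣ᶜ-+ₚ-cancelˡ p q k∣p+q k∣p = coeffwise-∣ λ i →
  ℤ.∣m+n∣m⇒∣n (subst (_ ℤ.∣_) (coeff-+ₚ p q i) (∣-coeff k∣p+q i)) (∣-coeff k∣p i)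

∣ᶜ-scale : ∀ {k} c p → k ℤ.∣ c → k ∣ᶜ scale c p
∣ᶜ-scale c p k∣c = coeffwise-∣ λ i →
  subst (_ ℤ.∣_) (sym (coeff-scale c p i)) (ℤ.∣m⇒∣m*n (coeff p i) k∣c)

∣ᶜ-quotient : ∀ {k p} → k ∣ᶜ p → ∃ λ p′ → scale k p′ ≋ p
∣ᶜ-quotient {p = []}    k∣p = [] , ≋-refl
∣ᶜ-quotient {k} {a ∷ p} k∣p with ∣ᶜ-head k∣p | ∣ᶜ-quotient (∣ᶜ-tail k∣p)
... | ℤ.divides q a≡qk | p′ , kp′≋p = q ∷ p′ , ∷-cong (trans (ℤ.*-comm k q) (sym a≡qk)) kp′≋p

∣ᶜ-scale-cancel : ∀ {j k q} → j ≢ 0ℤ → j ℤ.* k ∣ᶜ scale j q → k ∣ᶜ q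
∣ᶜ-scale-cancel {j} {q = q} j≢0 jk∣jq = coeffwise-∣ λ i →
  ℤ.*-cancelˡ-∣ j {{ℤ.≢-nonZero j≢0}} (subst (_ ℤ.∣_) (coeff-scale j q i) (∣-coeff jk∣jq i))

∣ᶜ-scale-mono : ∀ {j k q} → k ∣ᶜ q → j ℤ.* k ∣ᶜ scale j q
∣ᶜ-scale-mono {j} {q = q} k∣q = coeffwise-∣ λ i →
  subst (_ ℤ.∣_) (sym (coeff-scale j q i)) (ℤ.*-monoʳ-∣ j (∣-coeff k∣q i))

module _ {p} (p-prime : Prime p) where

  private
    P : ℤ
    P = + p

    P∣xy⇒P∣x⊎P∣y : ∀ x y → P ℤ.∣ x ℤ.* y → P ℤ.∣ x ⊎ P ℤ.∣ y
    P∣xy⇒P∣x⊎P∣y x y P∣xy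
      with euclidsLemma ℤ.∣ x ∣ ℤ.∣ y ∣ p-prime (subst (p ℕ.∣_) (ℤ.abs-* x y) (ℤ.∣⇒∣ᵤ P∣xy))
    ... | inj₁ p∣x = inj₁ (ℤ.∣ᵤ⇒∣ p∣x)
    ... | inj₂ p∣y = inj₂ (ℤ.∣ᵤ⇒∣ p∣y)

    ∣ᶜ-cancel-∤leading : ∀ a₀ a Y → ¬ P ℤ.∣ a₀ → P ∣ᶜ (a₀ ∷ a) *ₚ Y → P ∣ᶜ Y
    ∣ᶜ-cancel-∤leading a₀ a []       P∤a₀ _    = P ∣ᶜ[]
    ∣ᶜ-cancel-∤leading a₀ a (y₀ ∷ Y) P∤a₀ P∣AY = ∣ᶜ-∷ P∣y₀ (∣ᶜ-cancel-∤leading a₀ a Y P∤a₀ P∣A*Y)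
      where
      A = a₀ ∷ a
      P∣y₀ : P ℤ.∣ y₀
      P∣y₀ with P∣xy⇒P∣x⊎P∣y a₀ y₀ (subst (P ℤ.∣_) (ℤ.+-identityʳ (a₀ ℤ.* y₀)) (∣ᶜ-head P∣AY))
      ... | inj₁ P∣a₀ = contradiction P∣a₀ P∤a₀
      ... | inj₂ P∣y₀ = P∣y₀
      P∣A*Y : P ∣ᶜ A *ₚ Y
      P∣A*Y = ∣ᶜ-tail (∣ᶜ-+ₚ-cancelˡ (scale y₀ A) _ (∣ᶜ-resp-≋ (*ₚ-∷ʳ A y₀ Y) P∣AY) (∣ᶜ-scale y₀ A P∣y₀))

  ∣ᶜ-cancelˡ-prime : ∀ a Y → ¬ P ∣ᶜ a → P ∣ᶜ a *ₚ Y → P ∣ᶜ Y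
  ∣ᶜ-cancelˡ-prime []       Y P∤a _ = contradiction (P ∣ᶜ[]) P∤a
  ∣ᶜ-cancelˡ-prime (a₀ ∷ a) Y P∤a P∣aY with P ℤ.∣? a₀
  ... | no  P∤a₀ = ∣ᶜ-cancel-∤leading a₀ a Y P∤a₀ P∣aY
  ... | yes P∣a₀ = ∣ᶜ-cancelˡ-prime a Y (λ P∣a → P∤a (∣ᶜ-∷ P∣a₀ P∣a))
      (∣ᶜ-tail (∣ᶜ-+ₚ-cancelˡ (scale a₀ Y) _ P∣aY (∣ᶜ-scale a₀ Y P∣a₀)))

∣ᶜ-cancelˡ-product : ∀ {a} ps → All Prime ps → (∀ {p} → Prime p → p ℕ.∣ product ps → ¬ + p ∣ᶜ a) →
                     ∀ Y → + product ps ∣ᶜ a *ₚ Y → + product ps ∣ᶜ Y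
∣ᶜ-cancelˡ-product []       []               _       Y _ =
  coeffwise-∣ λ i → ℤ.divides (coeff Y i) (sym (ℤ.*-identityʳ _))
∣ᶜ-cancelˡ-product {a} (p ∷ ps) (p-prime ∷ ps-prime) p∤ᶜa Y pN∣aY =
  subst (_∣ᶜ Y) (sym (ℤ.pos-* p (product ps))) (∣ᶜ-resp-≋ pY′≋Y (∣ᶜ-scale-mono N∣Y′))
  where
  p∣Y : + p ∣ᶜ Y
  p∣Y = ∣ᶜ-cancelˡ-prime p-prime a Y (p∤ᶜa p-prime (ℕ.m∣m*n _)) (∣ᶜ-trans (ℤ.∣ᵤ⇒∣ (ℕ.m∣m*n _)) pN∣aY)
  Y′ : Poly
  Y′ = proj₁ (∣ᶜ-quotient p∣Y)
  pY′≋Y : scale (+ p) Y′ ≋ Y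
  pY′≋Y = proj₂ (∣ᶜ-quotient p∣Y)
  p≢0 : + p ≢ 0ℤ
  p≢0 p≡0 = ℕ.≢-nonZero⁻¹ p {{prime⇒nonZero p-prime}} (ℤ.+-injective p≡0)
  N∣aY′ : + product ps ∣ᶜ a *ₚ Y′
  N∣aY′ = ∣ᶜ-scale-cancel p≢0 (subst (_∣ᶜ scale (+ p) (a *ₚ Y′)) (ℤ.pos-* p (product ps))
            (∣ᶜ-resp-≋ (≋-trans (*ₚ-congʳ a (≋-sym pY′≋Y)) (*ₚ-scale (+ p) a Y′)) pN∣aY))
  N∣Y′ : + product ps ∣ᶜ Y′
  N∣Y′ = ∣ᶜ-cancelˡ-product ps ps-prime (λ q-prime q∣N → p∤ᶜa q-prime (ℕ.∣-trans q∣N (ℕ.n∣m*n p))) Y′ N∣aY′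

∣ᶜ-cancelˡ : ∀ {k a Y} → k ≢ 0ℤ → (∀ {p} → Prime p → p ℕ.∣ ℤ.∣ k ∣ → ¬ + p ∣ᶜ a) →
             k ∣ᶜ a *ₚ Y → k ∣ᶜ Y
∣ᶜ-cancelˡ {k} {a} {Y} k≢0 p∤ᶜa k∣aY =
  ∣ᶜ-trans ℤ.m∣∣m∣ (subst (_∣ᶜ Y) (cong +_ (sym isFactorisation)) ∏∣Y)
  where
  instance
    ∣k∣≢0 : ℕ.NonZero ℤ.∣ k ∣
    ∣k∣≢0 = ℕ.≢-nonZero (λ ∣k∣≡0 → k≢0 (ℤ.∣i∣≡0⇒i≡0 ∣k∣≡0))
  open PrimeFactorisation (factorise ℤ.∣ k ∣)
  ∏∣Y : + product factors ∣ᶜ Y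
  ∏∣Y = ∣ᶜ-cancelˡ-product factors factorsPrime
          (λ p-prime p∣∏ → p∤ᶜa p-prime (subst (_ ℕ.∣_) (sym isFactorisation) p∣∏)) Y
          (subst (_∣ᶜ a *ₚ Y) (cong +_ isFactorisation) (∣ᶜ-trans ℤ.∣m∣∣m k∣aY))

∣ᶜ-*ₚ : ∀ {k p} q → k ∣ᶜ p → k ∣ᶜ p *ₚ q
∣ᶜ-*ₚ {k} q k∣p with ∣ᶜ-quotient k∣p
... | p′ , kp′≋p =
  ∣ᶜ-resp-≋ (≋-trans (≋-sym (scale-*ₚ k p′ q)) (*ₚ-congˡ q kp′≋p)) (∣ᶜ-scale k (p′ *ₚ q) ℤ.∣-refl)

Primitive : Poly → Set
Primitive p = ∀ k → k ∣ᶜ p → ℤ.∣ k ∣ ≡ 1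

primitive⇒prime∤ᶜ : ∀ {a p} → Primitive a → Prime p → ¬ + p ∣ᶜ a
primitive⇒prime∤ᶜ a-primitive p-prime p∣a
  with ℕ.nonTrivial⇒n>1 _ {{prime⇒nonTrivial p-prime}} | a-primitive _ p∣a
... | ℕ.s≤s () | refl

primitive⇒≉[] : ∀ {a} → Primitive a → ¬ a ≋ []
primitive⇒≉[] a-primitive a≋[] with a-primitive (+ 2) (∣ᶜ-resp-≋ (≋-sym a≋[]) ((+ 2) ∣ᶜ[]))
... | ()

content : Poly → ℕ
content []      = 0
content (a ∷ p) = gcd ℤ.∣ a ∣ (content p)

content∣coeff : ∀ p i → content p ℕ.∣ ℤ.∣ coeff p i ∣
content∣coeff []      i       = ℕ._∣0 0
content∣coeff (a ∷ p) zero    = gcd[m,n]∣m ℤ.∣ a ∣ (content p)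
content∣coeff (a ∷ p) (suc i) = ℕ.∣-trans (gcd[m,n]∣n ℤ.∣ a ∣ (content p)) (content∣coeff p i)

∣coeff⇒∣content : ∀ {d} p → (∀ i → d ℕ.∣ ℤ.∣ coeff p i ∣) → d ℕ.∣ content p
∣coeff⇒∣content {d} []      d∣p = ℕ._∣0 d
∣coeff⇒∣content     (a ∷ p) d∣p = gcd-greatest (d∣p zero) (∣coeff⇒∣content p (λ i → d∣p (suc i)))

record ContentDecomposition (p : Poly) : Set where
  field
    scalar                  : ℤ
    primitivePart           : Poly
    scalar≢0                : scalar ≢ 0ℤ
    primitivePart-primitive : Primitive primitivePart
    decomposition           : scale scalar primitivePart ≋ p

content-decomposition : ∀ {p} → ¬ p ≋ [] → ContentDecomposition p
content-decomposition {p} p≉[] = record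
  { scalar                  = + content p
  ; primitivePart           = p′
  ; scalar≢0                = λ k≡0 → content≢0 (ℤ.+-injective k≡0)
  ; primitivePart-primitive = p′-primitive
  ; decomposition           = kp′≋p
  }
  where
  quotient = ∣ᶜ-quotient (coeffwise-∣ λ i → ℤ.∣ᵤ⇒∣ {+ content p} (content∣coeff p i))
  p′ = proj₁ quotient
  kp′≋p : scale (+ content p) p′ ≋ p
  kp′≋p = proj₂ quotient
  content≢0 : content p ≢ 0
  content≢0 c≡0 = p≉[] (coeffwise λ i →
    ℤ.∣i∣≡0⇒i≡0 (ℕ.0∣⇒≡0 (subst (ℕ._∣ ℤ.∣ coeff p i ∣) c≡0 (content∣coeff p i))))
  p′-primitive : Primitive p′
  p′-primitive j j∣p′ = ℕ.∣1⇒≡1 (ℕ.*-cancelˡ-∣ (content p) {{ℕ.≢-nonZero content≢0}}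
    (subst (content p ℕ.* ℤ.∣ j ∣ ℕ.∣_) (sym (ℕ.*-identityʳ (content p))) (∣coeff⇒∣content p kj∣p)))
    where
    kj∣p : ∀ i → content p ℕ.* ℤ.∣ j ∣ ℕ.∣ ℤ.∣ coeff p i ∣
    kj∣p i = subst (ℕ._∣ _) (ℤ.abs-* (+ content p) j)
               (ℤ.∣⇒∣ᵤ (∣-coeff (∣ᶜ-resp-≋ kp′≋p (∣ᶜ-scale-mono j∣p′)) i))

open CommutativeRingProperties ℤ[x]

∣-scale : ∀ {c p} k → c ∣ p → c ∣ scale k p
∣-scale {p = p} k c∣p = ∣ʳ-respʳ-≈ (const-*ₚ k p) (x∣ʳy⇒x∣ʳzy (const k) c∣p)

∣-scale-mono : ∀ {c p} k → c ∣ p → scale k c ∣ scale k p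
∣-scale-mono {c} {p} k (q , qc≋p) = q , ≋-trans (*ₚ-scale k q c) (scale-cong qc≋p)

∣ᶜ⇒const∣ : ∀ {k p} → k ∣ᶜ p → const k ∣ p
∣ᶜ⇒const∣ {k} k∣p with ∣ᶜ-quotient k∣p
... | p′ , kp′≋p = p′ , ≋-trans (*ₚ-comm p′ (const k)) (≋-trans (const-*ₚ k p′) kp′≋p)

const∣1⇒∣k∣≡1 : ∀ {k} → const k ∣ const 1ℤ → ℤ.∣ k ∣ ≡ 1
const∣1⇒∣k∣≡1 {k} (q , qk≋1) = ℕ.m*n≡1⇒m≡1 (ℤ.∣ k ∣) (ℤ.∣ coeff q 0 ∣) (begin
  ℤ.∣ k ∣ ℕ.* ℤ.∣ coeff q 0 ∣   ≡⟨ ℤ.abs-* k (coeff q 0) ⟨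
  ℤ.∣ k ℤ.* coeff q 0 ∣          ≡⟨ cong ℤ.∣_∣ (coeff-scale k q 0) ⟨
  ℤ.∣ coeff (scale k q) 0 ∣      ≡⟨ cong ℤ.∣_∣ (coeff-≡ kq≋1 0) ⟩
  1                              ∎)
  where
  open ≡-Reasoning
  kq≋1 : scale k q ≋ const 1ℤ
  kq≋1 = ≋-trans (≋-sym (const-*ₚ k q)) (≋-trans (*ₚ-comm (const k) q) qk≋1)

prime≢1 : ∀ {p} → Prime p → p ≢ 1
prime≢1 p-prime refl with ℕ.nonTrivial⇒n>1 1 {{prime⇒nonTrivial p-prime}}
... | ℕ.s≤s ()

coprime⇒no-common-prime : ∀ {a b p} → Coprime a b → Prime p → ¬ (+ p ∣ᶜ a × + p ∣ᶜ b)
coprime⇒no-common-prime a⊥b p-prime (p∣a , p∣b) =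
  prime≢1 p-prime (const∣1⇒∣k∣≡1 (a⊥b (∣ᶜ⇒const∣ p∣a) (∣ᶜ⇒const∣ p∣b)))

primitive-∣ : ∀ {e b} → Primitive b → e ∣ b → Primitive e
primitive-∣ {e} b-primitive (q , qe≋b) k k∣e =
  b-primitive k (∣ᶜ-resp-≋ (≋-trans (*ₚ-comm e q) qe≋b) (∣ᶜ-*ₚ q k∣e))

primitive-∣-scale : ∀ {e k Y} → Primitive e → k ≢ 0ℤ → e ∣ scale k Y → e ∣ Y
primitive-∣-scale {e} {k} {Y} e-primitive k≢0 (q , qe≋kY) =
  q′ , scale-cancel k≢0 (≋-trans (≋-sym (scale-*ₚ k q′ e)) (≋-trans (*ₚ-congˡ e kq′≋q) qe≋kY))
  where
  k∣q : k ∣ᶜ q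
  k∣q = ∣ᶜ-cancelˡ k≢0 (λ p-prime _ → primitive⇒prime∤ᶜ e-primitive p-prime)
          (∣ᶜ-resp-≋ (≋-sym (≋-trans (*ₚ-comm e q) qe≋kY)) (∣ᶜ-scale k Y ℤ.∣-refl))
  q′ : Poly
  q′ = proj₁ (∣ᶜ-quotient k∣q)
  kq′≋q : scale k q′ ≋ q
  kq′≋q = proj₂ (∣ᶜ-quotient k∣q)

DegreeBelow : Poly → ℕ → Set
DegreeBelow p n = ∀ i → n ℕ.≤ i → coeff p i ≡ 0ℤ

record HasDegree (p : Poly) (j : ℕ) : Set where
  field
    leading≢0 : coeff p j ≢ 0ℤ
    below     : DegreeBelow p (suc j)
open HasDegree

degreeBelow-length : ∀ p → DegreeBelow p (length p)
degreeBelow-length []      i       _           = refl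
degreeBelow-length (a ∷ p) (suc i) (ℕ.s≤s n≤i) = degreeBelow-length p i n≤i

degreeBelow-pred : ∀ {p n} → DegreeBelow p (suc n) → coeff p n ≡ 0ℤ → DegreeBelow p n
degreeBelow-pred p<1+n pₙ≡0 i n≤i with ℕ.m≤n⇒m<n∨m≡n n≤i
... | inj₁ n<i  = p<1+n i n<i
... | inj₂ refl = pₙ≡0

zero⊎degree : ∀ n {p} → DegreeBelow p n → p ≋ [] ⊎ ∃ λ j → j ℕ.< n × HasDegree p j
zero⊎degree zero    p<0 = inj₁ (coeffwise λ i → p<0 i ℕ.z≤n)
zero⊎degree (suc n) {p} p<1+n with coeff p n ℤ.≟ 0ℤ
... | no  pₙ≢0 = inj₂ (n , ℕ.≤-refl , record { leading≢0 = pₙ≢0 ; below = p<1+n })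
... | yes pₙ≡0 with zero⊎degree n (degreeBelow-pred {p} p<1+n pₙ≡0)
...   | inj₁ p≋[]              = inj₁ p≋[]
...   | inj₂ (j , j<n , p-deg) = inj₂ (j , ℕ.m≤n⇒m≤1+n j<n , p-deg)

≋[]-dec : ∀ p → p ≋ [] ⊎ ¬ p ≋ []
≋[]-dec p with zero⊎degree (length p) (degreeBelow-length p)
... | inj₁ p≋[]            = inj₁ p≋[]
... | inj₂ (j , _ , p-deg) = inj₂ λ p≋[] → leading≢0 p-deg (coeff-≡ p≋[] j)

primitive-degree : ∀ {p n} → Primitive p → DegreeBelow p n → ∃ λ j → j ℕ.< n × HasDegree p j
primitive-degree {n = n} p-primitive p<n with zero⊎degree n p<n
... | inj₁ p≋[]   = contradiction p≋[] (primitive⇒≉[] p-primitive)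
... | inj₂ degree = degree

degreeBelow-unscale : ∀ {k p q n} → k ≢ 0ℤ → scale k p ≋ q → DegreeBelow q n → DegreeBelow p n
degreeBelow-unscale {k} {p} k≢0 kp≋q q<n i n≤i = ℤ.*-cancelˡ-≡ k (coeff p i) 0ℤ {{ℤ.≢-nonZero k≢0}}
  (trans (sym (coeff-scale k p i)) (trans (coeff-≡ kp≋q i) (trans (q<n i n≤i) (sym (ℤ.*-zeroʳ k)))))

∣x∣≡1⇒x*x≡1 : ∀ x → ℤ.∣ x ∣ ≡ 1 → x ℤ.* x ≡ 1ℤ
∣x∣≡1⇒x*x≡1 (+ 1)     _ = refl
∣x∣≡1⇒x*x≡1 -[1+ 0 ] _ = refl

primitive-constant⇒unit : ∀ {b} → Primitive b → HasDegree b 0 → b ∣ const 1ℤ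
primitive-constant⇒unit {b} b-primitive b-deg = const b₀ , (begin
  const b₀ *ₚ b       ≈⟨ const-*ₚ b₀ b ⟩
  scale b₀ b          ≈⟨ scale-cong b≋b₀ ⟩
  const (b₀ ℤ.* b₀)   ≈⟨ ∷-cong (∣x∣≡1⇒x*x≡1 b₀ ∣b₀∣≡1) ≋-refl ⟩
  const 1ℤ            ∎)
  where
  open ≋-Reasoning
  b₀ = coeff b 0
  b≋b₀ : b ≋ const b₀
  b≋b₀ = coeffwise λ where
    zero    → refl
    (suc i) → below b-deg (suc i) (ℕ.s≤s ℕ.z≤n)
  ∣b₀∣≡1 : ℤ.∣ b₀ ∣ ≡ 1
  ∣b₀∣≡1 = b-primitive b₀ (∣ᶜ-resp-≋ (≋-sym b≋b₀) (∣ᶜ-∷ ℤ.∣-refl (b₀ ∣ᶜ[])))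

shift : ℕ → Poly → Poly
shift zero    p = p
shift (suc t) p = 0ℤ ∷ shift t p

coeff-shift : ∀ t p i → coeff (shift t p) (t ℕ.+ i) ≡ coeff p i
coeff-shift zero    p i = refl
coeff-shift (suc t) p i = coeff-shift t p i

shift-*ₚ : ∀ t p q → shift t p *ₚ q ≋ shift t (p *ₚ q)
shift-*ₚ zero    p q = ≋-refl
shift-*ₚ (suc t) p q = ≋-trans (*ₚ-shiftˡ (shift t p) q) (∷-congʳ (shift-*ₚ t p q))

∣-shift : ∀ {c p} t → c ∣ p → c ∣ shift t p
∣-shift zero    c∣p = c∣p
∣-shift {c} (suc t) c∣p with ∣-shift t c∣p
... | q , qc≋p = (0ℤ ∷ q) , ≋-trans (*ₚ-shiftˡ q c) (∷-congʳ qc≋p)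

-- bⱼ·a − aᵢ·xⁱ⁻ʲ·b for i = deg a ≥ j = deg b: the leading terms cancel.
remainder : Poly → Poly → ℕ → ℕ → Poly
remainder a b i j = scale (coeff b j) a +ₚ -ₚ scale (coeff a i) (shift (i ∸ j) b)

remainder-degreeBelow : ∀ {a b i j} → HasDegree a i → HasDegree b j → j ℕ.≤ i →
                        DegreeBelow (remainder a b i j) i
remainder-degreeBelow {a} {b} {i} {j} a-deg b-deg j≤i k i≤k =
  subst (λ k → coeff R k ≡ 0ℤ) (ℕ.m+[n∸m]≡n t≤k) (vanishes (k ∸ t) j≤k∸t)
  where
  t  = i ∸ j
  R  = remainder a b i j
  aᵢ = coeff a i
  bⱼ = coeff b j
  t≤k : t ℕ.≤ k
  t≤k = ℕ.≤-trans (ℕ.m∸n≤m i j) i≤k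
  j≤k∸t : j ℕ.≤ k ∸ t
  j≤k∸t = ℕ.m+n≤o⇒m≤o∸n j (subst (ℕ._≤ k) (sym (ℕ.m+[n∸m]≡n j≤i)) i≤k)
  coeff-R : ∀ k′ → coeff R (t ℕ.+ k′) ≡ bⱼ ℤ.* coeff a (t ℕ.+ k′) ℤ.+ -1ℤ ℤ.* (aᵢ ℤ.* coeff b k′)
  coeff-R k′ = trans (coeff-+ₚ (scale bⱼ a) (-ₚ scale aᵢ (shift t b)) (t ℕ.+ k′))
    (cong₂ ℤ._+_ (coeff-scale bⱼ a _) (trans (coeff-scale -1ℤ (scale aᵢ (shift t b)) _)
      (cong (-1ℤ ℤ.*_) (trans (coeff-scale aᵢ (shift t b) _) (cong (aᵢ ℤ.*_) (coeff-shift t b k′))))))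
  vanishes : ∀ k′ → j ℕ.≤ k′ → coeff R (t ℕ.+ k′) ≡ 0ℤ
  vanishes k′ j≤k′ with ℕ.m≤n⇒m<n∨m≡n j≤k′
  ... | inj₂ refl = trans (coeff-R j)
                      (trans (cong (λ x → bⱼ ℤ.* coeff a x ℤ.+ -1ℤ ℤ.* (aᵢ ℤ.* bⱼ)) (ℕ.m∸n+n≡m j≤i))
                             (leading-terms-cancel bⱼ aᵢ))
    where
    leading-terms-cancel : ∀ x y → x ℤ.* y ℤ.+ -1ℤ ℤ.* (y ℤ.* x) ≡ 0ℤ
    leading-terms-cancel = solve-∀
  ... | inj₁ j<k′ = trans (coeff-R k′) (trans (cong₂ (λ x y → bⱼ ℤ.* x ℤ.+ -1ℤ ℤ.* (aᵢ ℤ.* y))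
                      (below a-deg (t ℕ.+ k′) (subst (ℕ._< t ℕ.+ k′) (ℕ.m∸n+n≡m j≤i) (ℕ.+-monoʳ-< t j<k′)))
                      (below b-deg k′ j<k′))
                      (zero-terms bⱼ aᵢ))
    where
    zero-terms : ∀ x y → x ℤ.* 0ℤ ℤ.+ -1ℤ ℤ.* (y ℤ.* 0ℤ) ≡ 0ℤ
    zero-terms = solve-∀

remainder-∣ : ∀ {c X} a b i j → c ∣ a *ₚ X → c ∣ b *ₚ X → c ∣ remainder a b i j *ₚ X
remainder-∣ {c} {X} a b i j c∣aX c∣bX = ∣ʳ-respʳ-≈ (≋-sym RX≋) (∣x∣y⇒∣x+y
  (∣-scale (coeff b j) c∣aX)
  (∣-scale -1ℤ (∣-scale (coeff a i) (∣-shift (i ∸ j) c∣bX))))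
  where
  s = scale (coeff a i) (shift (i ∸ j) b)
  RX≋ : remainder a b i j *ₚ X ≋ scale (coeff b j) (a *ₚ X) +ₚ -ₚ scale (coeff a i) (shift (i ∸ j) (b *ₚ X))
  RX≋ = ≋-trans (*ₚ-distribʳ-+ₚ X (scale (coeff b j) a) (-ₚ s))
          (+ₚ-cong (scale-*ₚ (coeff b j) a X)
            (≋-trans (scale-*ₚ -1ℤ s X) (scale-cong
              (≋-trans (scale-*ₚ (coeff a i) (shift (i ∸ j) b) X) (scale-cong (shift-*ₚ (i ∸ j) b X))))))

∣remainder⇒∣scale : ∀ {e a b} i j → e ∣ remainder a b i j → e ∣ b → e ∣ scale (coeff b j) a
∣remainder⇒∣scale i j e∣R e∣b = ∣x+y∣y⇒∣x e∣R (∣-scale -1ℤ (∣-scale _ (∣-shift (i ∸ j) e∣b)))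

primitive-degrees : ∀ {a b na nb n} → na ℕ.+ nb ℕ.≤ n → DegreeBelow a na → DegreeBelow b nb →
                    Primitive a → Primitive b →
                    ∃ λ i → ∃ λ j → HasDegree a i × HasDegree b j × suc i ℕ.+ suc j ℕ.≤ n
primitive-degrees {a} {b} na+nb≤n a<na b<nb a-primitive b-primitive
  with primitive-degree {a} a-primitive a<na | primitive-degree {b} b-primitive b<nb
... | i , i<na , a-deg | j , j<nb , b-deg =
  i , j , a-deg , b-deg , ℕ.≤-trans (ℕ.+-mono-≤ i<na j<nb) na+nb≤n

-- Euclid's algorithm on pseudo-remainders of primitive polynomials; the degree sum drops at each step.
module _ {c X : Poly} (c-primitive : Primitive c) where

  CancelsBelow : ℕ → Set
  CancelsBelow n = ∀ {a b na nb} → na ℕ.+ nb ℕ.≤ n → DegreeBelow a na → DegreeBelow b nb →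
                   Primitive a → Primitive b → Coprime a b → c ∣ a *ₚ X → c ∣ b *ₚ X → c ∣ X

  descend : ∀ {n a b i j} → CancelsBelow n → j ℕ.≤ i → i ℕ.+ suc j ℕ.≤ n →
            HasDegree a i → HasDegree b j → Primitive a → Primitive b → Coprime a b →
            c ∣ a *ₚ X → c ∣ b *ₚ X → c ∣ X
  descend {j = zero} _ _ _ _ b-deg _ b-primitive _ _ c∣bX =
    ∣-unit-cancel (primitive-constant⇒unit b-primitive b-deg) c∣bX
  descend {a = a} {b} {i} {j@(suc _)} cancel j≤i bound a-deg b-deg a-primitive b-primitive a⊥b c∣aX c∣bX
    with ≋[]-dec (remainder a b i j)
  ... | inj₁ R≋[] = ∣-unit-cancel (a⊥b b∣a ∣ʳ-refl) c∣bX
    where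
    b∣a : b ∣ a
    b∣a = primitive-∣-scale b-primitive (leading≢0 b-deg)
            (∣remainder⇒∣scale i j (∣ʳ-respʳ-≈ (≋-sym R≋[]) (b ∣0)) ∣ʳ-refl)
  ... | inj₂ R≉[] =
    cancel bound (degreeBelow-unscale {k} {R′} k≢0 kR′≋R (remainder-degreeBelow a-deg b-deg j≤i))
           (below b-deg) R′-primitive b-primitive R′⊥b c∣R′X c∣bX
    where
    open ContentDecomposition (content-decomposition R≉[])
      renaming ( scalar to k; primitivePart to R′; scalar≢0 to k≢0
               ; primitivePart-primitive to R′-primitive; decomposition to kR′≋R)
    c∣R′X : c ∣ R′ *ₚ X
    c∣R′X = primitive-∣-scale c-primitive k≢0
              (∣ʳ-respʳ-≈ (≋-trans (*ₚ-congˡ X (≋-sym kR′≋R)) (scale-*ₚ k R′ X))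
                          (remainder-∣ a b i j c∣aX c∣bX))
    R′⊥b : Coprime R′ b
    R′⊥b e∣R′ e∣b = a⊥b (primitive-∣-scale (primitive-∣ b-primitive e∣b) (leading≢0 b-deg)
                      (∣remainder⇒∣scale i j (∣ʳ-respʳ-≈ kR′≋R (∣-scale k e∣R′)) e∣b)) e∣b

  coprime-cancel : ∀ n → CancelsBelow n
  coprime-cancel zero na+nb≤0 a<na b<nb a-primitive b-primitive _ _ _
    with primitive-degrees na+nb≤0 a<na b<nb a-primitive b-primitive
  ... | _ , _ , _ , _ , ()
  coprime-cancel (suc n) na+nb≤n a<na b<nb a-primitive b-primitive a⊥b c∣aX c∣bX
    with primitive-degrees na+nb≤n a<na b<nb a-primitive b-primitive
  ... | i , j , a-deg , b-deg , ℕ.s≤s i+1+j≤n with ℕ.≤-total j i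
  ...   | inj₁ j≤i = descend (coprime-cancel n) j≤i i+1+j≤n
                       a-deg b-deg a-primitive b-primitive a⊥b c∣aX c∣bX
  ...   | inj₂ i≤j = descend (coprime-cancel n) i≤j (subst (ℕ._≤ n) (i+[1+j]≡j+[1+i] i j) i+1+j≤n)
                       b-deg a-deg b-primitive a-primitive (Coprime-sym a⊥b) c∣bX c∣aX
    where
    i+[1+j]≡j+[1+i] : ∀ i j → i ℕ.+ suc j ≡ j ℕ.+ suc i
    i+[1+j]≡j+[1+i] i j = trans (ℕ.+-suc i j) (trans (cong suc (ℕ.+-comm i j)) (sym (ℕ.+-suc j i)))

euclid-primitive : ∀ {c a X} → Primitive c → Coprime c a → c ∣ a *ₚ X → c ∣ X
euclid-primitive {c} {a} {X} c-primitive c⊥a c∣aX with ≋[]-dec a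
... | inj₁ a≋[] = ∣ʳ-trans (c⊥a ∣ʳ-refl (∣ʳ-respʳ-≈ (≋-sym a≋[]) (c ∣0))) (1∣ X)
... | inj₂ a≉[] =
  coprime-cancel c-primitive (length a′ ℕ.+ length c) ℕ.≤-refl
    (degreeBelow-length a′) (degreeBelow-length c) a′-primitive c-primitive a′⊥c c∣a′X (x∣xy c X)
  where
  open ContentDecomposition (content-decomposition a≉[])
    renaming ( scalar to l; primitivePart to a′; scalar≢0 to l≢0
             ; primitivePart-primitive to a′-primitive; decomposition to la′≋a)
  c∣a′X : c ∣ a′ *ₚ X
  c∣a′X = primitive-∣-scale c-primitive l≢0
            (∣ʳ-respʳ-≈ (≋-trans (*ₚ-congˡ X (≋-sym la′≋a)) (scale-*ₚ l a′ X)) c∣aX)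
  a′⊥c : Coprime a′ c
  a′⊥c e∣a′ e∣c = c⊥a e∣c (∣ʳ-respʳ-≈ la′≋a (∣-scale l e∣a′))

euclid-decomposed : ∀ {k c′ c a X} → k ≢ 0ℤ → Primitive c′ → scale k c′ ≋ c →
                    Coprime c a → c ∣ a *ₚ X → c ∣ X
euclid-decomposed {k} {c′} {c} {a} {X} k≢0 c′-primitive kc′≋c c⊥a (q , qc≋aX) =
  ∣ʳ-respʳ-≈ kX′≋X (∣ʳ-respˡ-≈ kc′≋c (∣-scale-mono k c′∣X′))
  where
  kqc′≋aX : scale k (q *ₚ c′) ≋ a *ₚ X
  kqc′≋aX = ≋-trans (≋-sym (*ₚ-scale k q c′)) (≋-trans (*ₚ-congʳ q kc′≋c) qc≋aX)
  no-common-prime : ∀ {p} → Prime p → p ℕ.∣ ℤ.∣ k ∣ → ¬ + p ∣ᶜ a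
  no-common-prime p-prime p∣k p∣a = coprime⇒no-common-prime c⊥a p-prime
    (∣ᶜ-resp-≋ kc′≋c (∣ᶜ-scale k c′ (ℤ.∣ᵤ⇒∣ p∣k)) , p∣a)
  k∣X : k ∣ᶜ X
  k∣X = ∣ᶜ-cancelˡ k≢0 no-common-prime (∣ᶜ-resp-≋ kqc′≋aX (∣ᶜ-scale k (q *ₚ c′) ℤ.∣-refl))
  X′ : Poly
  X′ = proj₁ (∣ᶜ-quotient k∣X)
  kX′≋X : scale k X′ ≋ X
  kX′≋X = proj₂ (∣ᶜ-quotient k∣X)
  c′∣X′ : c′ ∣ X′
  c′∣X′ = euclid-primitive c′-primitive (λ e∣c′ → c⊥a (∣ʳ-respʳ-≈ kc′≋c (∣-scale k e∣c′)))
    (q , scale-cancel k≢0 (≋-trans (≋-sym (*ₚ-scale k q c′)) (≋-trans (*ₚ-congʳ q kc′≋c)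
           (≋-trans qc≋aX (≋-trans (*ₚ-congʳ a (≋-sym kX′≋X)) (*ₚ-scale k a X′))))))

euclid : HasEuclidsLemma
euclid {c} {a} {X} c⊥a c∣aX with ≋[]-dec c
... | inj₁ c≋[] = ∣-unit-cancel (c⊥a (∣ʳ-respʳ-≈ (≋-sym c≋[]) (a ∣0)) ∣ʳ-refl) c∣aX
... | inj₂ c≉[] = euclid-decomposed scalar≢0 primitivePart-primitive decomposition c⊥a c∣aX
  where open ContentDecomposition (content-decomposition c≉[])

∣ₚ⇒∣ : ∀ {a b} → a ∣ₚ b → a ∣ b
∣ₚ⇒∣ {a} (q , aq≈b) = q , ≋-trans (*ₚ-comm q a) (coeffwise aq≈b)

∣⇒∣ₚ : ∀ {a b} → a ∣ b → a ∣ₚ b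
∣⇒∣ₚ {a} (q , qa≋b) = q , coeff-≡ (≋-trans (*ₚ-comm a q) qa≋b)

IsGCD[1]⇒Coprime : ∀ {a b} → IsGCD (const 1ℤ) a b → Coprime a b
IsGCD[1]⇒Coprime (_ , _ , greatest) {c} c∣a c∣b = ∣ₚ⇒∣ {c} (greatest c (∣⇒∣ₚ c∣a) (∣⇒∣ₚ c∣b))

IsGCD-transfer : ∀ {h A A′ B} → (∀ {c} → c ∣ B → c ∣ A ⇔ c ∣ A′) → IsGCD h A B → IsGCD h A′ B
IsGCD-transfer {h} A⇔A′ (h∣A , h∣B , greatest) =
  ∣⇒∣ₚ (Equivalence.to (A⇔A′ (∣ₚ⇒∣ {h} h∣B)) (∣ₚ⇒∣ {h} h∣A)) , h∣B ,
  λ c c∣A′ c∣B → greatest c (∣⇒∣ₚ (Equivalence.from (A⇔A′ (∣ₚ⇒∣ {c} c∣B)) (∣ₚ⇒∣ {c} c∣A′))) c∣B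

module LucasType {p₀ p₁ d g} (gfp : IsGFP p₀ p₁ d g) (lucas : IsLucasType p₀ p₁ d g) where

  open Recurrence d g (G p₀ p₁ d g) (λ _ → ≋-refl) public

  d⊥g : Coprime d g
  d⊥g = IsGCD[1]⇒Coprime (IsGFP.gcd-dg gfp)

  2p₁≋p₀d : const (+ 2) *ₚ p₁ ≋ const p₀ *ₚ d
  2p₁≋p₀d = coeffwise (IsLucasType.2p₁≈p₀d lucas)

  p₁⊥g : Coprime p₁ g
  p₁⊥g = Coprime-∣-* euclid {const p₀} (IsGCD[1]⇒Coprime (IsLucasType.gcd-p₀g lucas)) d⊥g
           (const (+ 2) , 2p₁≋p₀d)

  p₀W≋2G : ∀ k → const p₀ *ₚ W k ≋ const (+ 2) *ₚ G p₀ p₁ d g k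
  p₀W≋2G = W-proportional {const p₀} {const (+ 2)}
             (∷-cong (cong (ℤ._+ 0ℤ) (ℤ.*-comm p₀ (+ 2))) ≋-refl) (≋-sym 2p₁≋p₀d)

  p₀-cancel : ∀ {x y} → const p₀ *ₚ x ≋ const p₀ *ₚ y → x ≋ y
  p₀-cancel {x} {y} p₀x≋p₀y = scale-cancel (IsLucasType.p₀≢0 lucas)
    (≋-trans (≋-sym (const-*ₚ p₀ x)) (≋-trans p₀x≋p₀y (const-*ₚ p₀ y)))

  G*W-sym : ∀ s t → G p₀ p₁ d g s *ₚ W t ≋ G p₀ p₁ d g t *ₚ W s
  G*W-sym = G*W-symmetric {const p₀} {const (+ 2)} p₀-cancel p₀W≋2G

open import Data.Nat using (_+_; _*_; _<_)

lemma14 : (p₀ : ℤ) (p₁ d g : Poly) → IsGFP p₀ p₁ d g → IsLucasType p₀ p₁ d g →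
          (n m q r : ℕ) → 0 < m → 0 < q → 0 < r → r < m → n ≡ m * q + r →
          ∀ (h : Poly) →
            (IsGCD h (G p₀ p₁ d g n) (G p₀ p₁ d g m) → IsGCD h (G p₀ p₁ d g (m₁ m q r)) (G p₀ p₁ d g m))
            × (IsGCD h (G p₀ p₁ d g (m₁ m q r)) (G p₀ p₁ d g m) → IsGCD h (G p₀ p₁ d g n) (G p₀ p₁ d g m))
lemma14 p₀ p₁ d g gfp lucas _ (suc m′) (suc q′) r _ _ _ r<m refl h =
  IsGCD-transfer {h} ∣Gₙ⇔∣Gₘ₁ , IsGCD-transfer {h} (λ c∣Gₘ → ⇔-sym (∣Gₙ⇔∣Gₘ₁ c∣Gₘ))
  where
  open LucasType gfp lucas
  ∣Gₙ⇔∣Gₘ₁ : ∀ {c} → c ∣ G p₀ p₁ d g (suc m′) →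
             c ∣ G p₀ p₁ d g (suc m′ * suc q′ + r) ⇔ c ∣ G p₀ p₁ d g (m₁ (suc m′) (suc q′) r)
  ∣Gₙ⇔∣Gₘ₁ = ∣G[mq+r]⇔∣G[m₁] euclid p₁⊥g d⊥g G*W-sym m′ q′ r r<m
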